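{- Let $R$ be a trapezoid representation of a trapezoid graph $G$, and let $V_i$ be a master component of a vertex $u$ of $G$ such that $R(V_i)\ll_R T_u$. Then $T_u\ll_R R(V_j)$ for every component $V_j\in D^*_u(V_i)$.
   Context: A trapezoid representation $R$ of $G$ assigns to each vertex $x$ a trapezoid $T_x$ between two horizontal parallel lines $L_1,L_2$ (two vertices on each line, all endpoints distinct), such that $xy$ is an edge iff $T_x\cap T_y\ne\emptyset$. For a vertex set $S$, $R(S)\ll_R T_u$ (resp. $T_u\ll_R R(S)$) means every trapezoid $T_x$, $x\in S$, lies completely to the left (resp. right) of $T_u$. $N(x)$ is the neighborhood of $x$, $N[x]=N(x)\cup\{x\}$, $N(W)=\bigcup_{w\in W}N(w)\setminus W$. Let $V_1,\ldots,V_\omega$ be the vertex sets of the connected components of $G\setminus N[u]$; $D_u(V_i)=\{V_p: N(V_p)\subseteq N(V_i)\}$, $D^*_u(V_i)=\{V_1,\ldots,V_\omega\}\setminus D_u(V_i)$, and $V_i$ is a master component of $u$ if $|D_u(V_i)|\ge|D_u(V_j)|$ for all $j$. -}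

module Defs where

open import Data.Nat using (ℕ; _<_)
open import Data.Fin using (Fin)
open import Data.Product using (Σ; _×_; ∃)
open import Data.Sum using (_⊎_; [_,_])
open import Function.Definitions using (Injective)
open import Function.Bundles using (_⇔_)
open import Relation.Binary.PropositionalEquality using (_≡_; _≢_)
open import Relation.Nullary using (¬_)

record Graph : Set₁ where
  field
    n      : ℕ
    E      : Fin n → Fin n → Set
    E-sym  : ∀ {x y} → E x y → E y x
    E-irr  : ∀ {x} → ¬ E x x

module _ (G : Graph) where
  open Graph G

  V : Set
  V = Fin n

  -- Trapezoid T_x has endpoints a x < b x on the
  -- line L1 and c x < d x on the line L2 (positions are natural numbers; only
  -- their order matters).  All endpoints on a line are pairwise distinct.
  record Trapezoids : Set where
    field
      a b c d : V → ℕ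
      a<b     : ∀ x → a x < b x
      c<d     : ∀ x → c x < d x
      distinct₁ : Injective _≡_ _≡_ [ a , b ]
      distinct₂ : Injective _≡_ _≡_ [ c , d ]

    _≪_ : V → V → Set
    x ≪ y = (b x < a y) × (d x < c y)

    -- T_x ∩ T_y ≠ ∅  (two trapezoids between L1, L2 are disjoint iff one lies
    -- completely to the left of the other).
    Intersect : V → V → Set
    Intersect x y = ¬ (x ≪ y) × ¬ (y ≪ x)

  record TrapRep : Set where
    field
      traps : Trapezoids
    open Trapezoids traps public
    field
      represents : ∀ x y → x ≢ y → (E x y ⇔ Intersect x y)

  Out : V → V → Set
  Out u w = (w ≢ u) × ¬ E u w

  -- Conn u v w : w lies in the connected component of G ∖ N[u] containing v.
  data Conn (u : V) : V → V → Set where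
    here : ∀ {v} → Out u v → Conn u v v
    step : ∀ {v w x} → Conn u v w → E w x → Out u x → Conn u v x

  NComp : V → V → V → Set
  NComp u v y = ¬ Conn u v y × ∃ λ w → Conn u v w × E w y

  -- V_p ∈ D_u(V_i)  iff  N(V_p) ⊆ N(V_i)   (components given by representatives)
  InD : V → V → V → Set
  InD u i p = ∀ y → NComp u p y → NComp u i y

  -- D_u(V_i) contains at least k distinct components of G ∖ N[u]
  AtLeast : V → V → ℕ → Set
  AtLeast u i k =
    Σ (Fin k → V) λ f →
      (∀ m → Out u (f m) × InD u i (f m)) ×
      (∀ m m' → m ≢ m' → ¬ Conn u (f m) (f m'))

  -- V_i (the component containing i) is a master component of u:
  -- |D_u(V_i)| ≥ |D_u(V_j)| for every component V_j.
  Master : V → V → Set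
  Master u i = Out u i × (∀ j → Out u j → ∀ k → AtLeast u j k → AtLeast u i k)

-- Two trapezoids are disjoint iff one lies completely to the left of the
-- other, so each vertex of G ∖ N[u] lies left or right of T_u, and by
-- connectivity a whole component of G ∖ N[u] lies on one side of T_u.
-- Suppose V_j lay left of T_u.  Of two distinct components left of T_u the
-- one further left is dominated by the other: a neighbour y of the left
-- component meets T_u as well, hence meets T_j for every j in between, so
-- N(V_left) ⊆ N(V_right).  As V_j ∉ D_u(V_i), this forces V_i ∈ D_u(V_j),
-- so D_u(V_j) ⊋ D_u(V_i).  Since V_i is a master component, iterating this
-- produces arbitrarily many distinct components in D_u(V_i), impossible in
-- a finite graph (pigeonhole).
module Submission where

open import Defs
open import Relation.Nullary using (¬_; Dec; yes; no)
open import Relation.Nullary.Decidable using (_×-dec_)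
open import Data.Nat using (zero; suc; _<?_)
open import Data.Nat.Properties using (<-trans; n<1+n)
open import Data.Fin using (Fin; zero; suc)
open import Data.Fin.Properties using (pigeonhole; _≟_; <⇒≢)
open import Data.Product using (_×_; _,_; proj₁; proj₂)
open import Data.Sum using (_⊎_; inj₁; inj₂; [_,_])
open import Data.Empty using (⊥; ⊥-elim)
open import Relation.Binary.PropositionalEquality using (refl; sym; subst; cong; _≢_)
open import Function.Bundles using (Equivalence)
open import Function using (id)

module Proof (G : Graph) (R : TrapRep G) where
  open Graph G
  open TrapRep R

  -- "Left of" is transitive: pass through the right ends of the middle trapezoid.
  ≪-trans : ∀ {x y z} → x ≪ y → y ≪ z → x ≪ z
  ≪-trans {y = y} (bx<ay , dx<cy) (by<az , dy<cz) =
    <-trans bx<ay (<-trans (a<b y) by<az) , <-trans dx<cy (<-trans (c<d y) dy<cz)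

  ≪? : ∀ x y → Dec (x ≪ y)
  ≪? x y = (b x <? a y) ×-dec (d x <? c y)

  ordered : ∀ {x y} → ¬ Intersect x y → x ≪ y ⊎ y ≪ x
  ordered {x} {y} disjoint with ≪? x y | ≪? y x
  ... | yes x≪y | _ = inj₁ x≪y
  ... | no _ | yes y≪x = inj₂ y≪x
  ... | no ¬x≪y | no ¬y≪x = ⊥-elim (disjoint (¬x≪y , ¬y≪x))

  meet-sym : ∀ {x y} → Intersect x y → Intersect y x
  meet-sym (¬x≪y , ¬y≪x) = ¬y≪x , ¬x≪y

  meet-between : ∀ {y a z u} → Intersect a y → Intersect y u → a ≪ z → z ≪ u → Intersect y z
  meet-between (¬a≪y , _) (¬y≪u , _) a≪z z≪u =
    (λ y≪z → ¬y≪u (≪-trans y≪z z≪u)) , (λ z≪y → ¬a≪y (≪-trans a≪z z≪y))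

  edge⇒meet : ∀ {x y} → E x y → Intersect x y
  edge⇒meet {x} {y} e with x ≟ y
  ... | yes refl = ⊥-elim (E-irr e)
  ... | no x≢y = Equivalence.to (represents x y x≢y) e

  meet⇒edge : ∀ {x y} → x ≢ y → Intersect x y → E x y
  meet⇒edge {x} {y} x≢y = Equivalence.from (represents x y x≢y)

  out⇒ordered : ∀ {u x} → Out G u x → x ≪ u ⊎ u ≪ x
  out⇒ordered (x≢u , ¬ux) =
    ordered λ meet → ¬ux (meet⇒edge (λ u≡x → x≢u (sym u≡x)) (meet-sym meet))

  ordered⇒out : ∀ {u x} → x ≢ u → x ≪ u ⊎ u ≪ x → Out G u x
  ordered⇒out x≢u side = x≢u , λ ux → [ proj₂ (edge⇒meet ux) , proj₁ (edge⇒meet ux) ] side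

  conn-out : ∀ {u v w} → Conn G u v w → Out G u w
  conn-out (here o) = o
  conn-out (step _ _ o) = o

  conn-trans : ∀ {u v w x} → Conn G u v w → Conn G u w x → Conn G u v x
  conn-trans p (here _) = p
  conn-trans p (step q e o) = step (conn-trans p q) e o

  conn-sym : ∀ {u v w} → Conn G u v w → Conn G u w v
  conn-sym (here o) = here o
  conn-sym (step p e o) = conn-trans (step (here o) (E-sym e) (conn-out p)) (conn-sym p)

  conn⇒InD : ∀ {u v w} → Conn G u v w → InD G u v w
  conn⇒InD cvw y (w↛y , x , cwx , e) =
    (λ cvy → w↛y (conn-trans (conn-sym cvw) cvy)) , x , conn-trans cvw cwx , e

  -- If every vertex of the component of v is apart from T_z, the whole
  -- component lies on the same side of T_z as T_v: an edge crossing from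
  -- the left of T_z to its right would join two non-intersecting trapezoids.
  stays-left : ∀ {u v x z} → (∀ y → Conn G u v y → y ≪ z ⊎ z ≪ y) →
               Conn G u v x → v ≪ z → x ≪ z
  stays-left apart (here _) v≪z = v≪z
  stays-left {x = x} apart cvx@(step cvw e _) v≪z with apart x cvx
  ... | inj₁ x≪z = x≪z
  ... | inj₂ z≪x = ⊥-elim (proj₁ (edge⇒meet e) (≪-trans (stays-left apart cvw v≪z) z≪x))

  stays-right : ∀ {u v x z} → (∀ y → Conn G u v y → y ≪ z ⊎ z ≪ y) →
                Conn G u v x → z ≪ v → z ≪ x
  stays-right apart (here _) z≪v = z≪v
  stays-right {x = x} apart cvx@(step cvw e _) z≪v with apart x cvx
  ... | inj₂ z≪x = z≪x
  ... | inj₁ x≪z = ⊥-elim (proj₂ (edge⇒meet e) (≪-trans x≪z (stays-right apart cvw z≪v)))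

  component-apart : ∀ {u v} y → Conn G u v y → y ≪ u ⊎ u ≪ y
  component-apart y cvy = out⇒ordered (conn-out cvy)

  component-side : ∀ {u j} → Out G u j →
    (∀ x → Conn G u j x → x ≪ u) ⊎ (∀ x → Conn G u j x → u ≪ x)
  component-side oj with out⇒ordered oj
  ... | inj₁ j≪u = inj₁ λ x cjx → stays-left component-apart cjx j≪u
  ... | inj₂ u≪j = inj₂ λ x cjx → stays-right component-apart cjx u≪j

  apart-from-other : ∀ {u v z} → Out G u z → ¬ Conn G u v z →
                     ∀ y → Conn G u v y → y ≪ z ⊎ z ≪ y
  apart-from-other {z = z} oz v↛z y cvy with y ≟ z
  ... | yes refl = ⊥-elim (v↛z cvy)
  ... | no y≢z = ordered λ meet → v↛z (step cvy (meet⇒edge y≢z meet) oz)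

  neighbour-not-out : ∀ {u v y} → NComp G u v y → ¬ Out G u y
  neighbour-not-out (v↛y , w , cvw , e) oy = v↛y (step cvw e oy)

  neighbour-meets-u : ∀ {u v y} → NComp G u v y → Intersect y u
  neighbour-meets-u {u} {y = y} ny@(_ , w , cvw , e) =
    (λ y≪u → not-out (ordered⇒out y≢u (inj₁ y≪u))) ,
    (λ u≪y → not-out (ordered⇒out y≢u (inj₂ u≪y)))
    where
      not-out = neighbour-not-out ny
      y≢u : y ≢ u
      y≢u refl = proj₂ (conn-out cvw) (E-sym e)

  -- If T_j lies left of T_u and the component V_i lies left of T_j, then
  -- N(V_i) ⊆ N(V_j): a neighbour of V_i meets T_u, so it meets T_j in between.
  left-dominated : ∀ {u i j} → Out G u j → j ≪ u →
                   (∀ w → Conn G u i w → w ≪ j) → InD G u j i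
  left-dominated {j = j} oj j≪u i≪j y ny@(_ , w , ciw , e) =
    (λ cjy → neighbour-not-out ny (conn-out cjy)) , j , here oj ,
    meet⇒edge j≢y (meet-sym (meet-between (edge⇒meet e) y-meets-u (i≪j w ciw) j≪u))
    where
      y-meets-u = neighbour-meets-u ny
      j≢y : j ≢ y
      j≢y refl = proj₁ y-meets-u j≪u

  -- Of two distinct components with T_i, T_j left of T_u, one dominates the
  -- other: the component further left is dominated by the one to its right.
  comparable : ∀ {u i j} → Out G u i → Out G u j → i ≪ u → j ≪ u →
    ¬ Conn G u i j → InD G u i j ⊎ InD G u j i
  comparable {u} {i} {j} oi oj i≪u j≪u i↛j with apart-from-other oj i↛j i (here oi)
  ... | inj₁ i≪j = inj₂ (left-dominated oj j≪u
                          λ w ciw → stays-left (apart-from-other oj i↛j) ciw i≪j)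
  ... | inj₂ j≪i = inj₁ (left-dominated oi i≪u
                          λ w cjw → stays-left (apart-from-other oi j↛i) cjw j≪i)
    where
      j↛i : ¬ Conn G u j i
      j↛i cji = i↛j (conn-sym cji)

  -- If V_i ∈ D_u(V_j) but V_j ∉ D_u(V_i), then D_u(V_j) contains D_u(V_i)
  -- together with V_j itself, which is not among the members of D_u(V_i).
  strict-extension : ∀ {u i j} → Out G u j → InD G u j i → ¬ InD G u i j →
                     ∀ k → AtLeast G u i k → AtLeast G u j (suc k)
  strict-extension {u} {j = j} oj i∈Dj j∉Di k (f , f-in-Di , f-distinct) =
    g , g-in-Dj , g-distinct
    where
      g : Fin (suc k) → V G
      g zero = j
      g (suc m) = f m
      g-in-Dj : ∀ m → Out G u (g m) × InD G u j (g m)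
      g-in-Dj zero = oj , λ y ny → ny
      g-in-Dj (suc m) = proj₁ (f-in-Di m) , λ y ny → i∈Dj y (proj₂ (f-in-Di m) y ny)
      f↛j : ∀ m → ¬ Conn G u (f m) j
      f↛j m c = j∉Di λ y ny → proj₂ (f-in-Di m) y (conn⇒InD c y ny)
      g-distinct : ∀ m m' → m ≢ m' → ¬ Conn G u (g m) (g m')
      g-distinct zero zero m≢m' _ = m≢m' refl
      g-distinct zero (suc m') _ c = f↛j m' (conn-sym c)
      g-distinct (suc m) zero _ c = f↛j m c
      g-distinct (suc m) (suc m') m≢m' c = f-distinct m m' (λ eq → m≢m' (cong suc eq)) c

  master-unbounded : ∀ {u i j} → Master G u i → Out G u j → InD G u j i → ¬ InD G u i j →
                     ∀ k → AtLeast G u i k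
  master-unbounded master oj i∈Dj j∉Di zero = (λ ()) , (λ ()) , λ ()
  master-unbounded master oj i∈Dj j∉Di (suc k) =
    proj₂ master _ oj (suc k)
      (strict-extension oj i∈Dj j∉Di k (master-unbounded master oj i∈Dj j∉Di k))

  atLeast-bounded : ∀ {u i} → ¬ AtLeast G u i (suc n)
  atLeast-bounded (f , f-in , f-distinct) with pigeonhole (n<1+n n) f
  ... | m , m' , m<m' , fm≡fm' =
    f-distinct m m' (<⇒≢ m<m') (subst (Conn G _ (f m)) fm≡fm' (here (proj₁ (f-in m))))

lemma2p6 : (G : Graph) (R : TrapRep G) (u i : V G) →
    Master G u i →
    (∀ w → Conn G u i w → TrapRep._≪_ R w u) →
    ∀ j → Out G u j → ¬ InD G u i j →
    ∀ w → Conn G u j w → TrapRep._≪_ R u w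
lemma2p6 G R u i master i-left j oj j∉Di =
  [ (λ j-left → ⊥-elim (j-not-left j-left)) , id ] (component-side oj)
  where
    open Proof G R
    -- V_j left of T_u would make V_i ∈ D_u(V_j), a strict dominance of V_i.
    j-not-left : (∀ w → Conn G u j w → TrapRep._≪_ R w u) → ⊥
    j-not-left j-left =
      [ j∉Di
      , (λ i∈Dj → atLeast-bounded (master-unbounded master oj i∈Dj j∉Di (suc (Graph.n G))))
      ] (comparable oi oj (i-left i (here oi)) (j-left j (here oj)) (λ cij → j∉Di (conn⇒InD cij)))
      where oi = proj₁ master
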